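{- Let $f:[q]^d\to\mathbb{F}$ be a symmetric function. Let $r\ge 1$, let $d_1,\dots,d_r\ge 0$ be integers with $d_1+d_2+\cdots+d_r=d$, and for $i=1,\dots,r$ let $\sigma_i,\tau_i\in[q]^{d_i}$. If $\mathrm{Peer}(\sigma_i,f)=\mathrm{Peer}(\tau_i,f)$ for all $i=1,\dots,r$, then $f(\tau_1\tau_2\cdots\tau_r)=f(\sigma_1\sigma_2\cdots\sigma_r)$, where $\sigma_1\sigma_2\cdots\sigma_r\in[q]^d$ denotes concatenation of tuples.
   Context: Fix an integer $q\ge 2$ and the domain $[q]=\{0,1,\dots,q-1\}$; $\mathbb{F}$ is a field ($\mathbb{C}$ or the nonnegative reals). A $d$-ary function $f:[q]^d\to\mathbb{F}$ ($d\ge 0$; a $0$-ary function is just a value) is symmetric if $f(x_1,\dots,x_d)=f(x_{\rho(1)},\dots,x_{\rho(d)})$ for every permutation $\rho$. For a symmetric $d$-ary $f$, $0\le k\le d$ and $\tau\in[q]^k$, the pinning $\mathrm{Pin}(\tau,f)$ is the symmetric $(d-k)$-ary function $g$ with $g(\sigma)=f(\sigma(1),\dots,\sigma(d-k),\tau(1),\dots,\tau(k))$ for all $\sigma\in[q]^{d-k}$. The peer function $\mathrm{Peer}(\tau,f)$ is the boolean symmetric $k$-ary function $g:[q]^k\to\{0,1\}$ with $g(\sigma)=1$ if $\mathrm{Pin}(\sigma,f)=\mathrm{Pin}(\tau,f)$ and $g(\sigma)=0$ otherwise. -}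

module Defs where

open import Data.Nat using (ℕ; zero; suc; _+_; _∸_; _≤_)
open import Data.Nat.Properties using (m∸n+n≡m; m≤m+n; m≤n⇒m≤o+n)
open import Data.Fin using (Fin; zero; suc)
open import Data.Fin.Permutation using (Permutation′; _⟨$⟩ʳ_)
open import Data.Vec using (Vec; []; _∷_; _++_; cast; lookup; tabulate; sum)
open import Function.Bundles using (_⇔_)
open import Relation.Binary.PropositionalEquality using (_≡_)

Fun : (q d : ℕ) → Set → Set
Fun q d A = Vec (Fin q) d → A

Symmetric : {q d : ℕ} {A : Set} → Fun q d A → Set
Symmetric {q} {d} f =
  (ρ : Permutation′ d) (x : Vec (Fin q) d) →
    f (tabulate (λ i → lookup x (ρ ⟨$⟩ʳ i))) ≡ f x

Pin : {q d k : ℕ} {A : Set} → k ≤ d → Vec (Fin q) k → Fun q d A → Fun q (d ∸ k) A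
Pin {d = d} {k} k≤d τ f σ = f (cast (m∸n+n≡m k≤d) (σ ++ τ))

-- Equality of functions (Pin(σ,f) = Pin(τ,f)) is taken extensionally.
_≗F_ : {q n : ℕ} {A : Set} → Fun q n A → Fun q n A → Set
g ≗F h = ∀ x → g x ≡ h x

-- Peer(τ, f) : the boolean function σ ↦ [Pin(σ,f) = Pin(τ,f)], represented as
-- the predicate "Peer(τ,f)(σ) = 1".
Peer : {q d k : ℕ} {A : Set} → k ≤ d → Vec (Fin q) k → Fun q d A → Vec (Fin q) k → Set
Peer k≤d τ f σ = Pin k≤d σ f ≗F Pin k≤d τ f

-- Peer(σ,f) = Peer(τ,f) as boolean functions: they take value 1 at the same points.
PeerEq : {q d k : ℕ} {A : Set} → k ≤ d → Fun q d A → Vec (Fin q) k → Vec (Fin q) k → Set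
PeerEq {q} {k = k} k≤d f σ τ = (ρ : Vec (Fin q) k) → Peer k≤d σ f ρ ⇔ Peer k≤d τ f ρ

lookup≤sum : {r : ℕ} (ds : Vec ℕ r) (i : Fin r) → lookup ds i ≤ sum ds
lookup≤sum (x ∷ ds) zero = m≤m+n x (sum ds)
lookup≤sum (x ∷ ds) (suc i) = m≤n⇒m≤o+n x (lookup≤sum ds i)

concatAll : {X : Set} {r : ℕ} (ds : Vec ℕ r) → ((i : Fin r) → Vec X (lookup ds i)) → Vec X (sum ds)
concatAll [] σs = []
concatAll (x ∷ ds) σs = σs zero ++ concatAll ds (λ i → σs (suc i))

-- Evaluating Peer(σᵢ,f) = Peer(τᵢ,f) at σᵢ gives Pin(σᵢ,f) = Pin(τᵢ,f), i.e. f(R σᵢ) = f(R τᵢ)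
-- for every context R: σᵢ and τᵢ are interchangeable as a trailing block. As f is symmetric,
-- any block can be moved to the end, so interchangeability is preserved by concatenation and
-- τ₁⋯τᵣ turns into σ₁⋯σᵣ block by block. Contexts are lists, so that moving a block is a
-- list permutation rather than a cast between vector lengths.
module Submission where

open import Defs
open import Data.Nat using (ℕ; suc; _≤_; _+_; _∸_)
open import Data.Nat.Properties using (m∸n+n≡m; m+n∸n≡m)
open import Data.Fin using (Fin; zero; suc)
import Data.Fin as Fin
open import Data.Fin.Permutation using (Permutation; _⟨$⟩ʳ_; _⟨$⟩ˡ_; _∘ₚ_; flip; cast-id; inverseʳ)
open import Data.Vec using (Vec; []; _∷_; lookup; sum; cast; tabulate; toList; fromList)
  renaming (_++_ to _++ᵛ_)
open import Data.Vec.Properties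
  using (toList-injective; toList-cast; toList∘fromList; toList-++; length-toList;
         lookup-cast; lookup-cast₁; tabulate∘lookup; tabulate-cong)
open import Data.Vec.Relation.Binary.Equality.Cast using (cast-is-id)
import Data.Vec.Functional.Relation.Binary.Permutation as Vector
open import Data.List as List using (List; length; _++_)
open import Data.List.Properties using (length-++)
open import Data.List.Relation.Binary.Permutation.Propositional
  using (_↭_; ↭-sym; ↭-trans; ↭-reflexive; ↭⇒↭ₛ)
open import Data.List.Relation.Binary.Permutation.Propositional.Properties
  using (↭-length; ++⁺ˡ; ++-comm; ++-assoc)
open import Data.List.Relation.Binary.Permutation.Setoid using (onIndices)
open import Data.List.Relation.Binary.Permutation.Setoid.Properties using (onIndices-lookup)
open import Data.Product using (_×_; _,_; proj₂)
open import Function using (_∘_)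
open import Function.Bundles using (Equivalence)
open import Relation.Binary.Bundles using (Setoid)
open import Relation.Binary.PropositionalEquality
  using (_≡_; refl; sym; trans; cong; setoid; module ≡-Reasoning)
import Relation.Binary.Reasoning.Setoid as SetoidReasoning

private
  variable
    X : Set
    k l n : ℕ

toList-injective-≡ : (x y : Vec X n) → toList x ≡ toList y → x ≡ y
toList-injective-≡ x y eq = trans (sym (cast-is-id refl x)) (toList-injective refl x y eq)

length-++-toList : (xs : List X) (ys : Vec X n) → length (xs ++ toList ys) ≡ length xs + n
length-++-toList xs ys = trans (length-++ xs) (cong (length xs +_) (length-toList ys))

lookup-fromList : (xs : List X) (i : Fin (length xs)) → lookup (fromList xs) i ≡ List.lookup xs i
lookup-fromList (x List.∷ xs) zero    = refl
lookup-fromList (x List.∷ xs) (suc i) = lookup-fromList xs i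

fromList-↭ : {xs ys : List X} → xs ↭ ys → .(e₁ : length xs ≡ n) .(e₂ : length ys ≡ n) →
             lookup (cast e₁ (fromList xs)) Vector.↭ lookup (cast e₂ (fromList ys))
fromList-↭ {X} {xs = xs} {ys} p e₁ e₂ = cast-id (sym e₂) ∘ₚ flip π ∘ₚ cast-id e₁ , λ i →
  let j = Fin.cast (sym e₂) i in begin
    lookup (cast e₁ (fromList xs)) (Fin.cast e₁ (π ⟨$⟩ˡ j)) ≡⟨ lookup-cast e₁ (fromList xs) _ ⟩
    lookup (fromList xs) (π ⟨$⟩ˡ j)                       ≡⟨ lookup-fromList xs _ ⟩
    List.lookup xs (π ⟨$⟩ˡ j)                             ≡⟨ onIndices-lookup (setoid X) (↭⇒↭ₛ p) _ ⟩
    List.lookup ys (π ⟨$⟩ʳ (π ⟨$⟩ˡ j))                    ≡⟨ cong (List.lookup ys) (inverseʳ π) ⟩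
    List.lookup ys j                                      ≡⟨ lookup-fromList ys j ⟨
    lookup (fromList ys) j                                ≡⟨ lookup-cast₁ e₂ (fromList ys) i ⟨
    lookup (cast e₂ (fromList ys)) i                      ∎
  where
  open ≡-Reasoning
  π : Permutation (length xs) (length ys)
  π = onIndices (↭⇒↭ₛ p)

module _ {q d : ℕ} {A : Set} (f : Fun q d A) where

  onList : (L : List (Fin q)) → .(length L ≡ d) → A
  onList L e = f (cast e (fromList L))

  onList-toList : (x : Vec (Fin q) d) {L : List (Fin q)} → toList x ≡ L →
                  .(e : length L ≡ d) → onList L e ≡ f x
  onList-toList x {L} x≡L e = cong f (toList-injective-≡ _ x (begin
    toList (cast e (fromList L)) ≡⟨ toList-cast e (fromList L) ⟩
    toList (fromList L)          ≡⟨ toList∘fromList L ⟩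
    L                            ≡⟨ x≡L ⟨
    toList x                     ∎))
    where open ≡-Reasoning

  -- The length component makes the relation transitive: the middle list then has length d too.
  Indistinguishable : List (Fin q) → List (Fin q) → Set
  Indistinguishable L M =
    length L ≡ length M × (.(e : length L ≡ d) .(e′ : length M ≡ d) → onList L e ≡ onList M e′)

  indistinguishable-setoid : Setoid _ _
  indistinguishable-setoid = record
    { Carrier       = List (Fin q)
    ; _≈_           = Indistinguishable
    ; isEquivalence = record
      { refl  = refl , λ _ _ → refl
      ; sym   = λ (eq , agree) → sym eq , λ e e′ → sym (agree e′ e)
      ; trans = λ (eq₁ , agree₁) (eq₂ , agree₂) →
                  trans eq₁ eq₂ , λ e e′ → trans (agree₁ e (trans (sym eq₁) e)) (agree₂ _ e′)
      }
    }

  Interchangeable : Vec (Fin q) k → Vec (Fin q) k → Set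
  Interchangeable σ τ = ∀ R → Indistinguishable (R ++ toList σ) (R ++ toList τ)

  interchangeable⇒≡ : {σ τ : Vec (Fin q) d} → Interchangeable σ τ → f σ ≡ f τ
  interchangeable⇒≡ {σ} {τ} σ∼τ = begin
    f σ                            ≡⟨ onList-toList σ refl (length-toList σ) ⟨
    onList (toList σ) _            ≡⟨ proj₂ (σ∼τ List.[]) (length-toList σ) (length-toList τ) ⟩
    onList (toList τ) _            ≡⟨ onList-toList τ refl (length-toList τ) ⟩
    f τ                            ∎
    where open ≡-Reasoning

  onList-pin : (k≤d : k ≤ d) (R : List (Fin q)) (ρ : Vec (Fin q) k)
               .(R-fits : length R ≡ d ∸ k) .(e : length (R ++ toList ρ) ≡ d) →
               onList (R ++ toList ρ) e ≡ Pin k≤d ρ f (cast R-fits (fromList R))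
  onList-pin {k} k≤d R ρ R-fits = onList-toList _ (begin
    toList (cast (m∸n+n≡m k≤d) (context ++ᵛ ρ)) ≡⟨ toList-cast (m∸n+n≡m k≤d) (context ++ᵛ ρ) ⟩
    toList (context ++ᵛ ρ)                      ≡⟨ toList-++ context ρ ⟩
    toList context ++ toList ρ                  ≡⟨ cong (_++ toList ρ) (toList-cast R-fits (fromList R)) ⟩
    toList (fromList R) ++ toList ρ             ≡⟨ cong (_++ toList ρ) (toList∘fromList R) ⟩
    R ++ toList ρ                               ∎)
    where
    open ≡-Reasoning
    context : Vec (Fin q) (d ∸ k)
    context = cast R-fits (fromList R)

  pinEq⇒interchangeable : (k≤d : k ≤ d) {σ τ : Vec (Fin q) k} →
                          Pin k≤d σ f ≗F Pin k≤d τ f → Interchangeable σ τ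
  pinEq⇒interchangeable {k} k≤d {σ} {τ} pinEq R =
    trans (length-++-toList R σ) (sym (length-++-toList R τ)) , λ e e′ →
      trans (onList-pin k≤d R σ (R-fits σ e) e)
            (trans (pinEq _) (sym (onList-pin k≤d R τ (R-fits σ e) e′)))
    where
    R-fits : (ρ : Vec (Fin q) k) → length (R ++ toList ρ) ≡ d → length R ≡ d ∸ k
    R-fits ρ e = trans (sym (m+n∸n≡m (length R) k))
                       (cong (_∸ k) (trans (sym (length-++-toList R ρ)) e))

module _ {q d : ℕ} {A : Set} (f : Fun q d A) (f-sym : Symmetric f) where

  symmetric-↭ : {x y : Vec (Fin q) d} → lookup x Vector.↭ lookup y → f x ≡ f y
  symmetric-↭ {x} {y} (ρ , x∘ρ≡y) = begin
    f x                                      ≡⟨ f-sym ρ x ⟨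
    f (tabulate (λ i → lookup x (ρ ⟨$⟩ʳ i))) ≡⟨ cong f (tabulate-cong x∘ρ≡y) ⟩
    f (tabulate (lookup y))                  ≡⟨ cong f (tabulate∘lookup y) ⟩
    f y                                      ∎
    where open ≡-Reasoning

  ↭⇒indistinguishable : {L M : List (Fin q)} → L ↭ M → Indistinguishable f L M
  ↭⇒indistinguishable p = ↭-length p , λ e e′ → symmetric-↭ (fromList-↭ p e e′)

  interchangeable-++ : {σ τ : Vec (Fin q) k} {σ′ τ′ : Vec (Fin q) l} →
                       Interchangeable f σ τ → Interchangeable f σ′ τ′ →
                       Interchangeable f (σ ++ᵛ σ′) (τ ++ᵛ τ′)
  interchangeable-++ {σ = σ} {τ} {σ′} {τ′} σ∼τ σ′∼τ′ R = begin
    R ++ toList (σ ++ᵛ σ′)        ≈⟨ ↭⇒indistinguishable (↭-trans (↭-reflexive (cong (R ++_) (toList-++ σ σ′)))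
                                                                  (move-to-end R (toList σ) (toList σ′))) ⟩
    (R ++ toList σ′) ++ toList σ  ≈⟨ σ∼τ (R ++ toList σ′) ⟩
    (R ++ toList σ′) ++ toList τ  ≈⟨ ↭⇒indistinguishable (↭-trans (++-assoc R (toList σ′) (toList τ))
                                                                  (move-to-end R (toList σ′) (toList τ))) ⟩
    (R ++ toList τ) ++ toList σ′  ≈⟨ σ′∼τ′ (R ++ toList τ) ⟩
    (R ++ toList τ) ++ toList τ′  ≈⟨ ↭⇒indistinguishable (↭-trans (++-assoc R (toList τ) (toList τ′))
                                                                  (↭-reflexive (cong (R ++_) (sym (toList-++ τ τ′))))) ⟩
    R ++ toList (τ ++ᵛ τ′)        ∎
    where
    open SetoidReasoning (indistinguishable-setoid f)

    move-to-end : (R S T : List (Fin q)) → R ++ (S ++ T) ↭ (R ++ T) ++ S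
    move-to-end R S T = ↭-trans (++⁺ˡ R (++-comm S T)) (↭-sym (++-assoc R T S))

  interchangeable-concatAll : {m : ℕ} (ds : Vec ℕ m) (σs τs : (i : Fin m) → Vec (Fin q) (lookup ds i)) →
                              (∀ i → Interchangeable f (σs i) (τs i)) →
                              Interchangeable f (concatAll ds σs) (concatAll ds τs)
  interchangeable-concatAll []       _  _  _     R = Setoid.refl (indistinguishable-setoid f)
  interchangeable-concatAll (_ ∷ ds) σs τs σs∼τs =
    interchangeable-++ (σs∼τs zero) (interchangeable-concatAll ds (σs ∘ suc) (τs ∘ suc) (σs∼τs ∘ suc))

peerEq⇒pinEq : {q d : ℕ} {A : Set} (k≤d : k ≤ d) (f : Fun q d A) {σ τ : Vec (Fin q) k} →
               PeerEq k≤d f σ τ → Pin k≤d σ f ≗F Pin k≤d τ f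
peerEq⇒pinEq _ _ {σ} peerEq = Equivalence.to (peerEq σ) (λ _ → refl)

mainTheorem1 : (q : ℕ) → 2 ≤ q → (A : Set) → (r : ℕ) → (ds : Vec ℕ (suc r))
    → (f : Fun q (sum ds) A) → Symmetric f
    → (σs τs : (i : Fin (suc r)) → Vec (Fin q) (lookup ds i))
    → ((i : Fin (suc r)) → PeerEq (lookup≤sum ds i) f (σs i) (τs i))
    → f (concatAll ds τs) ≡ f (concatAll ds σs)
mainTheorem1 _ _ _ _ ds f f-sym σs τs peerEqs =
  sym (interchangeable⇒≡ f (interchangeable-concatAll f f-sym ds σs τs λ i →
    pinEq⇒interchangeable f (lookup≤sum ds i) (peerEq⇒pinEq (lookup≤sum ds i) f (peerEqs i))))
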